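{- Let $\Lambda$ be a lattice, $D\in\mathrm{End}(\Lambda)$ with $\Lambda[D]=\Lambda[D^2]$, and $\Lambda'\subseteq\Lambda$ a $D$-stable sublattice of maximal rank. Then for all positive integers $e$, $$\mathfrak{B}_{\Lambda,e\Lambda'}=e\,\mathfrak{B}_{\Lambda,\Lambda'}\cong\frac{\mathfrak{B}_{\Lambda,\Lambda'}}{\mathfrak{B}_{\Lambda,\Lambda'}[e]}.$$
   Context: $D$ is extended to $V=\Lambda\otimes_{\mathbb{Z}}\mathbb{Q}$; $V[D]=\ker D$, $D^{ -1}M=\{v\in V:Dv\in M\}$, and $\mathfrak{B}_{\Lambda,M}=\dfrac{\Lambda+D^{ -1}M}{\Lambda+V[D]}$ for a $D$-stable full-rank sublattice $M\subseteq\Lambda$. $\mathfrak{B}[e]$ denotes $e$-torsion. -}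

module Defs where

open import Data.Nat.Base using (ℕ; zero; suc; NonZero)
open import Data.Fin.Base using (Fin)
open import Data.Integer.Base as ℤ using (ℤ; +_)
import Data.Integer.Properties as ℤP
open import Data.Rational.Base as ℚ using (ℚ; mkℚ; _+_; _*_; -_; _-_; 0ℚ)
import Data.Rational.Properties as ℚP
open import Data.Nat.Coprimality using (sym; 1-coprimeTo)
open import Data.Maybe.Base using (Maybe; just; nothing)
open import Data.Product using (Σ; ∃; ∃-syntax; _×_; _,_; proj₁; proj₂)
open import Relation.Nullary using (yes; no)
open import Relation.Binary.PropositionalEquality
  using (_≡_; _≗_; refl; cong; cong₂; trans) renaming (sym to ≡-sym)
open import Algebra.Bundles using (RawGroup)
import Algebra.Bundles
import Algebra.Properties.Semiring.Sum as SemiringSum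
open import Tactic.RingSolver.Core.AlmostCommutativeRing using (fromCommutativeRing; AlmostCommutativeRing)
open import Level using (0ℓ)
import Tactic.RingSolver as RS

-- Conventions.
-- The lattice Λ is ℤⁿ (every lattice of rank n is isomorphic to ℤⁿ),
-- so V = Λ ⊗ ℚ = ℚⁿ, and an endomorphism D of Λ is an integer n×n
-- matrix, acting on ℚⁿ by the same matrix.

Vecℤ : ℕ → Set
Vecℤ n = Fin n → ℤ

Vecℚ : ℕ → Set
Vecℚ n = Fin n → ℚ

Matℤ : ℕ → Set
Matℤ n = Fin n → Fin n → ℤ

module Σℤ = SemiringSum ℤP.+-*-semiring
module Σℚ = SemiringSum (Algebra.Bundles.CommutativeRing.semiring ℚP.+-*-commutativeRing)

ι : ℤ → ℚ
ι z = mkℚ z 0 (sym (1-coprimeTo ℤ.∣ z ∣))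

ιᵥ : ∀ {n} → Vecℤ n → Vecℚ n
ιᵥ x i = ι (x i)

0ℤᵥ : ∀ {n} → Vecℤ n
0ℤᵥ _ = + 0

_+ℤᵥ_ : ∀ {n} → Vecℤ n → Vecℤ n → Vecℤ n
(x +ℤᵥ y) i = x i ℤ.+ y i

-ℤᵥ_ : ∀ {n} → Vecℤ n → Vecℤ n
(-ℤᵥ x) i = ℤ.- x i

_·ℤᵥ_ : ∀ {n} → ℕ → Vecℤ n → Vecℤ n
(e ·ℤᵥ x) i = + e ℤ.* x i

0ᵥ : ∀ {n} → Vecℚ n
0ᵥ _ = 0ℚ

_+ᵥ_ : ∀ {n} → Vecℚ n → Vecℚ n → Vecℚ n
(v +ᵥ w) i = v i + w i

-ᵥ_ : ∀ {n} → Vecℚ n → Vecℚ n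
(-ᵥ v) i = - v i

_-ᵥ_ : ∀ {n} → Vecℚ n → Vecℚ n → Vecℚ n
(v -ᵥ w) i = v i - w i

_·ᵥ_ : ∀ {n} → ℕ → Vecℚ n → Vecℚ n
(e ·ᵥ v) i = ι (+ e) * v i

applyℤ : ∀ {n} → Matℤ n → Vecℤ n → Vecℤ n
applyℤ D x i = Σℤ.sum (λ j → D i j ℤ.* x j)

applyℚ : ∀ {n} → Matℤ n → Vecℚ n → Vecℚ n
applyℚ D v i = Σℚ.sum (λ j → ι (D i j) * v j)

record Sublattice (n : ℕ) : Set₁ where
  field
    _∈L     : Vecℤ n → Set
    ∈-resp  : ∀ {x y} → x ≗ y → x ∈L → y ∈L
    ∈-zero  : 0ℤᵥ ∈L
    ∈-+     : ∀ {x y} → x ∈L → y ∈L → (x +ℤᵥ y) ∈L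
    ∈-neg   : ∀ {x} → x ∈L → (-ℤᵥ x) ∈L
open Sublattice public

DStable : ∀ {n} → Matℤ n → Sublattice n → Set
DStable D L = ∀ x → _∈L L x → _∈L L (applyℤ D x)

MaximalRank : ∀ {n} → Sublattice n → Set
MaximalRank {n} L =
  Σ (Fin n → Vecℤ n) λ b → ((∀ i → _∈L L (b i)) ×
          (∀ (c : Vecℚ n) →
             (∀ k → Σℚ.sum (λ i → c i * ι (b i k)) ≡ 0ℚ) →
             ∀ i → c i ≡ 0ℚ))

KerD≡KerD² : ∀ {n} → Matℤ n → Set
KerD≡KerD² D = ∀ x → (applyℤ D x ≗ 0ℤᵥ → applyℤ D (applyℤ D x) ≗ 0ℤᵥ)
                   × (applyℤ D (applyℤ D x) ≗ 0ℤᵥ → applyℤ D x ≗ 0ℤᵥ)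

private
  dec0 : ∀ x → Maybe (0ℚ ≡ x)
  dec0 x with 0ℚ ℚP.≟ x
  ... | yes p = just p
  ... | no _  = nothing

  ℚ-ACR : AlmostCommutativeRing 0ℓ 0ℓ
  ℚ-ACR = fromCommutativeRing ℚP.+-*-commutativeRing dec0


ι-+ : ∀ a b → ι a + ι b ≡ ι (a ℤ.+ b)
ι-+ a b = trans (cong (λ z → z ℚ./ 1) (cong₂ ℤ._+_ (ℤP.*-identityʳ a) (ℤP.*-identityʳ b)))
               (ℚP.↥p/↧p≡p (ι (a ℤ.+ b)))

ι-neg : ∀ a → - ι a ≡ ι (ℤ.- a)
ι-neg (+ zero)   = refl
ι-neg (+ suc n)  = refl
ι-neg ℤ.-[1+ n ] = refl

private
  negUnique : ∀ x y → x + y ≡ 0ℚ → x ≡ - y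
  negUnique x y p = trans (solve' x y) (trans (cong (_+ (- y)) p) (ℚP.+-identityˡ (- y)))
    where
    solve' : ∀ x y → x ≡ (x + y) + (- y)
    solve' = RS.solve-∀ ℚ-ACR

apply-+ : ∀ {n} (D : Matℤ n) v w → applyℚ D (v +ᵥ w) ≗ (applyℚ D v +ᵥ applyℚ D w)
apply-+ D v w i = trans (Σℚ.sum-cong-≗ (λ j → ℚP.*-distribˡ-+ (ι (D i j)) (v j) (w j)))
                        (Σℚ.∑-distrib-+ (λ j → ι (D i j) * v j) (λ j → ι (D i j) * w j))

apply-0 : ∀ {n} (D : Matℤ n) → applyℚ D 0ᵥ ≗ 0ᵥ
apply-0 {n} D i = trans (Σℚ.sum-cong-≗ (λ j → ℚP.*-zeroʳ (ι (D i j)))) (Σℚ.sum-replicate-zero n)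

apply-neg : ∀ {n} (D : Matℤ n) v → applyℚ D (-ᵥ v) ≗ (-ᵥ applyℚ D v)
apply-neg D v i = negUnique _ _
  (trans (≡-sym (apply-+ D (-ᵥ v) v i))
   (trans (Σℚ.sum-cong-≗ (λ j → cong (ι (D i j) *_) (ℚP.+-inverseˡ (v j)))) (apply-0 D i)))

_·L_ : ∀ {n} → ℕ → Sublattice n → Sublattice n
e ·L L = record
  { _∈L    = λ x → ∃[ y ] (_∈L L y × x ≗ (e ·ℤᵥ y))
  ; ∈-resp = λ { p (y , yL , q) → y , yL , (λ i → trans (≡-sym (p i)) (q i)) }
  ; ∈-zero = 0ℤᵥ , ∈-zero L , (λ i → ≡-sym (ℤP.*-zeroʳ (+ e)))
  ; ∈-+    = λ { (y , yL , q) (y' , yL' , q') → (y +ℤᵥ y') , ∈-+ L yL yL' ,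
                 (λ i → trans (cong₂ ℤ._+_ (q i) (q' i)) (≡-sym (ℤP.*-distribˡ-+ (+ e) (y i) (y' i)))) }
  ; ∈-neg  = λ { (y , yL , q) → (-ℤᵥ y) , ∈-neg L yL ,
                 (λ i → trans (cong ℤ.-_ (q i)) (ℤP.neg-distribʳ-* (+ e) (y i))) }
  }

InDinv : ∀ {n} → Matℤ n → Sublattice n → Vecℚ n → Set
InDinv D M w = ∃[ m ] (_∈L M m × applyℚ D w ≗ ιᵥ m)

InΛ+Dinv : ∀ {n} → Matℤ n → Sublattice n → Vecℚ n → Set
InΛ+Dinv D M v = ∃[ l ] ∃[ w ] (InDinv D M w × v ≗ (ιᵥ l +ᵥ w))

InVD : ∀ {n} → Matℤ n → Vecℚ n → Set
InVD D k = applyℚ D k ≗ 0ᵥ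

InN : ∀ {n} → Matℤ n → Vecℚ n → Set
InN D v = ∃[ l ] ∃[ k ] (InVD D k × v ≗ (ιᵥ l +ᵥ k))

-- 𝔅_{Λ,M} ⊆ V / (Λ + V[D]) : a class [v] lies in 𝔅_{Λ,M} iff it has a
-- representative in Λ + D⁻¹M
InB : ∀ {n} → Matℤ n → Sublattice n → Vecℚ n → Set
InB D M v = ∃[ u ] (InΛ+Dinv D M u × InN D (v -ᵥ u))

InEB : ∀ {n} → Matℤ n → ℕ → Sublattice n → Vecℚ n → Set
InEB D e M v = ∃[ u ] (InB D M u × InN D (v -ᵥ (e ·ᵥ u)))

InBtors : ∀ {n} → Matℤ n → ℕ → Sublattice n → Vecℚ n → Set
InBtors D e M v = InB D M v × InN D (e ·ᵥ v)

InN-resp : ∀ {n} (D : Matℤ n) {v v'} → v ≗ v' → InN D v → InN D v'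
InN-resp D p (l , k , kD , q) = l , k , kD , (λ i → trans (≡-sym (p i)) (q i))

InN-0 : ∀ {n} (D : Matℤ n) → InN D 0ᵥ
InN-0 D = 0ℤᵥ , 0ᵥ , apply-0 D , (λ i → refl)

InN-+ : ∀ {n} (D : Matℤ n) {v v'} → InN D v → InN D v' → InN D (v +ᵥ v')
InN-+ D (l , k , kD , q) (l' , k' , kD' , q') =
  (l +ℤᵥ l') , (k +ᵥ k') ,
  (λ i → trans (apply-+ D k k' i) (cong₂ _+_ (kD i) (kD' i))) ,
  (λ i → trans (cong₂ _+_ (q i) (q' i))
         (trans (lem (ι (l i)) (k i) (ι (l' i)) (k' i))
                (cong (_+ (k i + k' i)) (ι-+ (l i) (l' i)))))
  where
  lem : ∀ a b c d → (a + b) + (c + d) ≡ (a + c) + (b + d)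
  lem = RS.solve-∀ ℚ-ACR

InN-neg : ∀ {n} (D : Matℤ n) {v} → InN D v → InN D (-ᵥ v)
InN-neg D (l , k , kD , q) =
  (-ℤᵥ l) , (-ᵥ k) ,
  (λ i → trans (apply-neg D k i) (cong -_ (kD i))) ,
  (λ i → trans (cong -_ (q i)) (trans (ℚP.neg-distrib-+ (ι (l i)) (k i))
                                      (cong (_+ (- k i)) (ι-neg (l i)))))

InDinv-0 : ∀ {n} (D : Matℤ n) M → InDinv D M 0ᵥ
InDinv-0 D M = 0ℤᵥ , ∈-zero M , apply-0 D

InDinv-+ : ∀ {n} (D : Matℤ n) M {w w'} → InDinv D M w → InDinv D M w' → InDinv D M (w +ᵥ w')
InDinv-+ D M {w} {w'} (m , mM , q) (m' , mM' , q') =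
  (m +ℤᵥ m') , ∈-+ M mM mM' ,
  (λ i → trans (apply-+ D w w' i) (trans (cong₂ _+_ (q i) (q' i)) (ι-+ (m i) (m' i))))

InDinv-neg : ∀ {n} (D : Matℤ n) M {w} → InDinv D M w → InDinv D M (-ᵥ w)
InDinv-neg D M {w} (m , mM , q) =
  (-ℤᵥ m) , ∈-neg M mM ,
  (λ i → trans (apply-neg D w i) (trans (cong -_ (q i)) (ι-neg (m i))))

InΛ+Dinv-0 : ∀ {n} (D : Matℤ n) M → InΛ+Dinv D M 0ᵥ
InΛ+Dinv-0 D M = 0ℤᵥ , 0ᵥ , InDinv-0 D M , (λ i → refl)

InΛ+Dinv-+ : ∀ {n} (D : Matℤ n) M {v v'} → InΛ+Dinv D M v → InΛ+Dinv D M v' → InΛ+Dinv D M (v +ᵥ v')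
InΛ+Dinv-+ D M (l , w , wD , q) (l' , w' , wD' , q') =
  (l +ℤᵥ l') , (w +ᵥ w') , InDinv-+ D M {w} {w'} wD wD' ,
  (λ i → trans (cong₂ _+_ (q i) (q' i))
         (trans (lem (ι (l i)) (w i) (ι (l' i)) (w' i))
                (cong (_+ (w i + w' i)) (ι-+ (l i) (l' i)))))
  where
  lem : ∀ a b c d → (a + b) + (c + d) ≡ (a + c) + (b + d)
  lem = RS.solve-∀ ℚ-ACR

InΛ+Dinv-neg : ∀ {n} (D : Matℤ n) M {v} → InΛ+Dinv D M v → InΛ+Dinv D M (-ᵥ v)
InΛ+Dinv-neg D M (l , w , wD , q) =
  (-ℤᵥ l) , (-ᵥ w) , InDinv-neg D M {w} wD ,
  (λ i → trans (cong -_ (q i)) (trans (ℚP.neg-distrib-+ (ι (l i)) (w i))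
                                      (cong (_+ (- w i)) (ι-neg (l i)))))

InB-0 : ∀ {n} (D : Matℤ n) M → InB D M 0ᵥ
InB-0 D M = 0ᵥ , InΛ+Dinv-0 D M , InN-resp D (λ i → ℚP.+-inverseʳ 0ℚ) (InN-0 D)

InB-+ : ∀ {n} (D : Matℤ n) M {v v'} → InB D M v → InB D M v' → InB D M (v +ᵥ v')
InB-+ D M {v} {v'} (u , uM , r) (u' , uM' , r') =
  (u +ᵥ u') , InΛ+Dinv-+ D M {u} {u'} uM uM' ,
  InN-resp D (λ i → ≡-sym (lem (v i) (v' i) (u i) (u' i))) (InN-+ D r r')
  where
  lem : ∀ a b c d → (a + b) - (c + d) ≡ (a - c) + (b - d)
  lem = RS.solve-∀ ℚ-ACR

InB-neg : ∀ {n} (D : Matℤ n) M {v} → InB D M v → InB D M (-ᵥ v)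
InB-neg D M {v} (u , uM , r) =
  (-ᵥ u) , InΛ+Dinv-neg D M {u} uM ,
  InN-resp D (λ i → lem (v i) (u i)) (InN-neg D r)
  where
  lem : ∀ a c → - (a - c) ≡ (- a) - (- c)
  lem = RS.solve-∀ ℚ-ACR

InEB-0 : ∀ {n} (D : Matℤ n) e M → InEB D e M 0ᵥ
InEB-0 D e M = 0ᵥ , InB-0 D M , InN-resp D (λ i → lem (ι (+ e))) (InN-0 D)
  where
  lem : ∀ c → 0ℚ ≡ 0ℚ - c * 0ℚ
  lem = RS.solve-∀ ℚ-ACR

InEB-+ : ∀ {n} (D : Matℤ n) e M {v v'} → InEB D e M v → InEB D e M v' → InEB D e M (v +ᵥ v')
InEB-+ D e M {v} {v'} (u , uM , r) (u' , uM' , r') =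
  (u +ᵥ u') , InB-+ D M {u} {u'} uM uM' ,
  InN-resp D (λ i → ≡-sym (lem (v i) (v' i) (u i) (u' i) (ι (+ e)))) (InN-+ D r r')
  where
  lem : ∀ a b c d f → (a + b) - f * (c + d) ≡ (a - f * c) + (b - f * d)
  lem = RS.solve-∀ ℚ-ACR

InEB-neg : ∀ {n} (D : Matℤ n) e M {v} → InEB D e M v → InEB D e M (-ᵥ v)
InEB-neg D e M {v} (u , uM , r) =
  (-ᵥ u) , InB-neg D M {u} uM ,
  InN-resp D (λ i → lem (v i) (u i) (ι (+ e))) (InN-neg D r)
  where
  lem : ∀ a c f → - (a - f * c) ≡ (- a) - f * (- c)
  lem = RS.solve-∀ ℚ-ACR

-- The groups appearing in the statement, as raw groups whose carriers
-- are representatives in V and whose equality is congruence modulo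
-- the relevant subgroup (quotients as setoids).

BmodTors : ∀ {n} → Matℤ n → ℕ → Sublattice n → RawGroup 0ℓ 0ℓ
BmodTors {n} D e M = record
  { Carrier = Σ (Vecℚ n) (InB D M)
  ; _≈_     = λ x y → InBtors D e M (proj₁ x -ᵥ proj₁ y)
  ; _∙_     = λ x y → (proj₁ x +ᵥ proj₁ y) , InB-+ D M {proj₁ x} {proj₁ y} (proj₂ x) (proj₂ y)
  ; ε       = 0ᵥ , InB-0 D M
  ; _⁻¹     = λ x → (-ᵥ proj₁ x) , InB-neg D M {proj₁ x} (proj₂ x)
  }

EB : ∀ {n} → Matℤ n → ℕ → Sublattice n → RawGroup 0ℓ 0ℓ
EB {n} D e M = record
  { Carrier = Σ (Vecℚ n) (InEB D e M)
  ; _≈_     = λ x y → InN D (proj₁ x -ᵥ proj₁ y)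
  ; _∙_     = λ x y → (proj₁ x +ᵥ proj₁ y) , InEB-+ D e M {proj₁ x} {proj₁ y} (proj₂ x) (proj₂ y)
  ; ε       = 0ᵥ , InEB-0 D e M
  ; _⁻¹     = λ x → (-ᵥ proj₁ x) , InEB-neg D e M {proj₁ x} (proj₂ x)
  }

-- Over ℚ the preimage D⁻¹(eM) is just e·D⁻¹M, and Λ is killed in V/(Λ + V[D]);
-- hence Λ + D⁻¹(eM) and e(Λ + D⁻¹M) agree modulo Λ + V[D], i.e. 𝔅_{Λ,eΛ'} = e𝔅_{Λ,Λ'}.
-- Multiplication by e maps 𝔅_{Λ,Λ'} onto e𝔅_{Λ,Λ'} with kernel 𝔅_{Λ,Λ'}[e], which gives
-- the isomorphism. Neither step uses Λ[D] = Λ[D²], D-stability or maximal rank.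
module Submission where

open import Defs
open import Data.Nat.Base using (ℕ; NonZero)
open import Data.Product using (Σ; ∃; _×_; _,_)
open import Function.Bundles using (_⇔_; mk⇔)
open import Algebra.Morphism.Structures using (IsGroupIsomorphism)
open import Data.Integer.Base as ℤ using (+_)
open import Data.Rational.Base using (ℚ; _+_; _*_; -_; _-_; 0ℚ; 1ℚ; 1/_)
import Data.Rational.Properties as ℚP
open import Data.Maybe.Base using (Maybe; just; nothing)
open import Relation.Nullary using (yes; no)
open import Relation.Binary.PropositionalEquality
open import Tactic.RingSolver.Core.AlmostCommutativeRing using (fromCommutativeRing; AlmostCommutativeRing)
open import Level using (0ℓ)
open import Tactic.RingSolver using (solve-∀)

private
  ℚ-ring : AlmostCommutativeRing 0ℓ 0ℓ
  ℚ-ring = fromCommutativeRing ℚP.+-*-commutativeRing isZero?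
    where
    isZero? : ∀ x → Maybe (0ℚ ≡ x)
    isZero? x with 0ℚ ℚP.≟ x
    ... | yes p = just p
    ... | no _  = nothing

ι-* : ∀ a b → ι a * ι b ≡ ι (a ℤ.* b)
ι-* a b = ℚP.↥p/↧p≡p (ι (a ℤ.* b))

infixr 7 _⋆_

_⋆_ : ∀ {n} → ℚ → Vecℚ n → Vecℚ n
(c ⋆ v) i = c * v i

module _ {n : ℕ} (D : Matℤ n) where

  applyℚ-⋆ : ∀ c v → applyℚ D (c ⋆ v) ≗ c ⋆ applyℚ D v
  applyℚ-⋆ c v i =
    trans (Σℚ.sum-cong-≗ (λ j → swap (ι (D i j)) c (v j)))
          (sym (Σℚ.*-distribˡ-sum c (λ j → ι (D i j) * v j)))
    where
    swap : ∀ x c y → x * (c * y) ≡ c * (x * y)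
    swap = solve-∀ ℚ-ring

  ≗0ᵥ⇒InN : ∀ {x} → x ≗ 0ᵥ → InN D x
  ≗0ᵥ⇒InN x≗0 = InN-resp D (λ i → sym (x≗0 i)) (InN-0 D)

  InN-ιᵥ : ∀ l → InN D (ιᵥ l)
  InN-ιᵥ l = l , 0ᵥ , apply-0 D , (λ i → sym (ℚP.+-identityʳ (ι (l i))))

  InN-·ᵥ : ∀ e {x} → InN D x → InN D (e ·ᵥ x)
  InN-·ᵥ e {x} (l , k , Dk≗0 , x≗l+k) =
    (e ·ℤᵥ l) , (E ⋆ k) ,
    (λ i → begin
      applyℚ D (E ⋆ k) i  ≡⟨ applyℚ-⋆ E k i ⟩
      E * applyℚ D k i    ≡⟨ cong (E *_) (Dk≗0 i) ⟩
      E * 0ℚ              ≡⟨ ℚP.*-zeroʳ E ⟩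
      0ℚ                  ∎) ,
    (λ i → begin
      E * x i                   ≡⟨ cong (E *_) (x≗l+k i) ⟩
      E * (ι (l i) + k i)       ≡⟨ ℚP.*-distribˡ-+ E (ι (l i)) (k i) ⟩
      E * ι (l i) + E * k i     ≡⟨ cong (_+ E * k i) (ι-* (+ e) (l i)) ⟩
      ι (+ e ℤ.* l i) + E * k i ∎)
    where
    open ≡-Reasoning
    E = ι (+ e)

  module _ (M : Sublattice n) (e : ℕ) where

    private
      E = ι (+ e)

    InDinv-·ᵥ : ∀ {w} → InDinv D M w → InDinv D (e ·L M) (e ·ᵥ w)
    InDinv-·ᵥ {w} (m , m∈M , Dw≗m) =
      (e ·ℤᵥ m) , (m , m∈M , λ _ → refl) ,
      (λ i → trans (applyℚ-⋆ E w i) (trans (cong (E *_) (Dw≗m i)) (ι-* (+ e) (m i))))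

    InΛ+Dinv-·ᵥ : ∀ {u} → InΛ+Dinv D M u → InΛ+Dinv D (e ·L M) (e ·ᵥ u)
    InΛ+Dinv-·ᵥ {u} (l , w , w∈ , u≗l+w) =
      (e ·ℤᵥ l) , (e ·ᵥ w) , InDinv-·ᵥ {w} w∈ ,
      (λ i → trans (cong (E *_) (u≗l+w i))
             (trans (ℚP.*-distribˡ-+ E (ι (l i)) (w i))
                    (cong (_+ E * w i) (ι-* (+ e) (l i)))))

    module _ .{{_ : NonZero e}} where

      *-1/-cancelˡ : ∀ x → E * ((1/ E) * x) ≡ x
      *-1/-cancelˡ x = begin
        E * ((1/ E) * x)  ≡⟨ ℚP.*-assoc E (1/ E) x ⟨
        (E * 1/ E) * x    ≡⟨ cong (_* x) (ℚP.*-inverseʳ E) ⟩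
        1ℚ * x            ≡⟨ ℚP.*-identityˡ x ⟩
        x                 ∎
        where open ≡-Reasoning

      InDinv-·L⇒ : ∀ {w} → InDinv D (e ·L M) w → InDinv D M ((1/ E) ⋆ w)
      InDinv-·L⇒ {w} (_ , (m , m∈M , m'≗em) , Dw≗m') = m , m∈M , λ i → begin
        applyℚ D ((1/ E) ⋆ w) i   ≡⟨ applyℚ-⋆ (1/ E) w i ⟩
        (1/ E) * applyℚ D w i     ≡⟨ cong ((1/ E) *_) (trans (Dw≗m' i) (cong ι (m'≗em i))) ⟩
        (1/ E) * ι (+ e ℤ.* m i)  ≡⟨ cong ((1/ E) *_) (ι-* (+ e) (m i)) ⟨
        (1/ E) * (E * ι (m i))    ≡⟨ ℚP.*-assoc (1/ E) E (ι (m i)) ⟨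
        ((1/ E) * E) * ι (m i)    ≡⟨ cong (_* ι (m i)) (ℚP.*-inverseˡ E) ⟩
        1ℚ * ι (m i)              ≡⟨ ℚP.*-identityˡ (ι (m i)) ⟩
        ι (m i)                   ∎
        where open ≡-Reasoning

  InDinv⇒InB : ∀ M {w} → InDinv D M w → InB D M w
  InDinv⇒InB M {w} w∈ =
    w , (0ℤᵥ , w , w∈ , (λ i → sym (ℚP.+-identityˡ (w i)))) ,
    ≗0ᵥ⇒InN (λ i → ℚP.+-inverseʳ (w i))

  InB-·L⇒InEB : ∀ M e .{{_ : NonZero e}} {v} → InB D (e ·L M) v → InEB D e M v
  InB-·L⇒InEB M e {v} (u , (l , w , w∈ , u≗l+w) , v-u∈N) =
    (1/ E) ⋆ w , InDinv⇒InB M {(1/ E) ⋆ w} (InDinv-·L⇒ M e {w} w∈) ,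
    InN-resp D (λ i → begin
      (v i - u i) + ι (l i)              ≡⟨ cong (λ t → (v i - t) + ι (l i)) (u≗l+w i) ⟩
      (v i - (ι (l i) + w i)) + ι (l i)  ≡⟨ regroup (v i) (ι (l i)) (w i) ⟩
      v i - w i                          ≡⟨ cong (λ t → v i - t) (*-1/-cancelˡ M e (w i)) ⟨
      v i - E * ((1/ E) * w i)           ∎)
      (InN-+ D v-u∈N (InN-ιᵥ l))
    where
    open ≡-Reasoning
    E = ι (+ e)
    regroup : ∀ v a w → (v - (a + w)) + a ≡ v - w
    regroup = solve-∀ ℚ-ring

  InEB⇒InB-·L : ∀ M e {v} → InEB D e M v → InB D (e ·L M) v
  InEB⇒InB-·L M e {v} (u , (u₀ , u₀∈ , u-u₀∈N) , v-eu∈N) =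
    e ·ᵥ u₀ , InΛ+Dinv-·ᵥ M e {u₀} u₀∈ ,
    InN-resp D (λ i → regroup (v i) (u i) (u₀ i) (ι (+ e)))
      (InN-+ D v-eu∈N (InN-·ᵥ e u-u₀∈N))
    where
    regroup : ∀ v u u₀ f → (v - f * u) + f * (u - u₀) ≡ v - f * u₀
    regroup = solve-∀ ℚ-ring

  module _ (M : Sublattice n) (e : ℕ) where

    private
      E = ι (+ e)

    ·ᵥ-InB : Σ (Vecℚ n) (InB D M) → Σ (Vecℚ n) (InEB D e M)
    ·ᵥ-InB (x , x∈) = e ·ᵥ x , x , x∈ , ≗0ᵥ⇒InN (λ i → ℚP.+-inverseʳ (E * x i))

    ·ᵥ-InB-isGroupIsomorphism : IsGroupIsomorphism (BmodTors D e M) (EB D e M) ·ᵥ-InB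
    ·ᵥ-InB-isGroupIsomorphism = record
      { isGroupMonomorphism = record
        { isGroupHomomorphism = record
          { isMonoidHomomorphism = record
            { isMagmaHomomorphism = record
              { isRelHomomorphism = record
                { cong = λ {(x , _)} {(y , _)} (_ , e[x-y]∈N) →
                    InN-resp D (λ i → *-distrib-− E (x i) (y i)) e[x-y]∈N }
              ; homo = λ (x , _) (y , _) → ≗0ᵥ⇒InN (λ i → additive E (x i) (y i))
              }
            ; ε-homo = ≗0ᵥ⇒InN (λ _ → maps-zero E)
            }
          ; ⁻¹-homo = λ (x , _) → ≗0ᵥ⇒InN (λ i → maps-neg E (x i))
          }
        ; injective = λ {(x , x∈)} {(y , y∈)} ex-ey∈N →
            InB-+ D M {x} { -ᵥ y} x∈ (InB-neg D M {y} y∈) ,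
            InN-resp D (λ i → sym (*-distrib-− E (x i) (y i))) ex-ey∈N
        }
      ; surjective = λ (v , u , u∈ , v-eu∈N) → (u , u∈) , λ {(z , _)} (_ , e[z-u]∈N) →
          InN-resp D (λ i → regroup E (z i) (u i) (v i)) (InN-+ D e[z-u]∈N (InN-neg D v-eu∈N))
      }
      where
      *-distrib-− : ∀ f x y → f * (x - y) ≡ f * x - f * y
      *-distrib-− = solve-∀ ℚ-ring
      additive : ∀ f x y → f * (x + y) - (f * x + f * y) ≡ 0ℚ
      additive = solve-∀ ℚ-ring
      maps-zero : ∀ f → f * 0ℚ - 0ℚ ≡ 0ℚ
      maps-zero = solve-∀ ℚ-ring
      maps-neg : ∀ f x → f * (- x) - (- (f * x)) ≡ 0ℚ
      maps-neg = solve-∀ ℚ-ring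
      regroup : ∀ f z u v → f * (z - u) + (- (v - f * u)) ≡ f * z - v
      regroup = solve-∀ ℚ-ring

proposition2p2p4 : (n : ℕ) (D : Matℤ n) → KerD≡KerD² D →
    (L : Sublattice n) → DStable D L → MaximalRank L →
    (e : ℕ) → .{{_ : NonZero e}} →
    ((v : Vecℚ n) → InB D (e ·L L) v ⇔ InEB D e L v)
    × ∃ (IsGroupIsomorphism (BmodTors D e L) (EB D e L))
proposition2p2p4 n D _ L _ _ e =
  (λ v → mk⇔ (InB-·L⇒InEB D L e {v}) (InEB⇒InB-·L D L e {v})) ,
  (·ᵥ-InB D L e , ·ᵥ-InB-isGroupIsomorphism D L e)
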